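{- Let $G$ be a finite simple connected graph of order $n(G)$ and let $k\ge \ell\ge 0$ be integers. Then $\mathrm{f}\mu^{k}(G)=n(G)-\ell$ if and only if $\omega(G)=n(G)-\ell$, where $\omega(G)$ is the clique number of $G$.
   Context: For an integer $k\ge 0$ and a connected graph $G$, a set $X\subseteq V(G)$ is a $k$-fault-tolerant mutual-visibility set ($k$-ftmv set) if for any two non-adjacent vertices $u,v\in X$ there exist $k+1$ internally vertex-disjoint shortest $u,v$-paths $Q_1,\dots,Q_{k+1}$ in $G$ such that $V(Q_i)\cap X=\{u,v\}$ for every $i$. $\mathrm{f}\mu^{k}(G)$ denotes the maximum cardinality of a $k$-ftmv set of $G$. -}

module Defs where

open import Data.Nat using (ℕ; suc; _≤_; _+_)
open import Data.Bool using (Bool; true; false)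
open import Data.Fin using (Fin)
open import Data.Fin.Subset using (Subset; _∈_; _∉_; ∣_∣)
open import Data.List using (List; []; _∷_; length; _++_; [_])
open import Data.List.Relation.Unary.Unique.Propositional using (Unique)
import Data.List.Membership.Propositional as LM
open import Data.Vec using (Vec; lookup)
open import Data.Product using (Σ; _×_; ∃)
open import Data.Empty using (⊥)
open import Relation.Binary.PropositionalEquality using (_≡_; _≢_)

record Graph (n : ℕ) : Set where
  field
    adj     : Fin n → Fin n → Bool
    symm    : ∀ u v → adj u v ≡ adj v u
    irrefl  : ∀ u → adj u u ≡ false
open Graph public

module _ {n : ℕ} (G : Graph n) where

  Adj : Fin n → Fin n → Set
  Adj u v = adj G u v ≡ true

  -- Chain u xs v : u ~ x₁ ~ ... ~ xₘ ~ v, where xs = [x₁ … xₘ] are the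
  -- internal vertices of a u,v-walk with length xs + 1 edges.
  Chain : Fin n → List (Fin n) → Fin n → Set
  Chain u []       v = Adj u v
  Chain u (x ∷ xs) v = Adj u x × Chain x xs v

  IsPath : Fin n → List (Fin n) → Fin n → Set
  IsPath u xs v = Chain u xs v × Unique (u ∷ xs ++ [ v ])

  IsShortestPath : Fin n → List (Fin n) → Fin n → Set
  IsShortestPath u xs v =
    IsPath u xs v × (∀ ys → Chain u ys v → length xs ≤ length ys)

  Connected : Set
  Connected = ∀ (u v : Fin n) → u ≢ v → ∃ λ xs → IsPath u xs v

  IsKFTMV : ℕ → Subset n → Set
  IsKFTMV k X =
    ∀ u v → u ∈ X → v ∈ X → u ≢ v → adj G u v ≡ false →
    Σ (Vec (List (Fin n)) (suc k)) λ Q →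
      (∀ i → IsShortestPath u (lookup Q i) v)
      × (∀ i j → i ≢ j → ∀ x → x LM.∈ lookup Q i → x LM.∈ lookup Q j → ⊥)
      × (∀ i x → x LM.∈ lookup Q i → x ∉ X)

  FMuIs : ℕ → ℕ → Set
  FMuIs k m = (Σ (Subset n) λ X → IsKFTMV k X × ∣ X ∣ ≡ m)
            × (∀ X → IsKFTMV k X → ∣ X ∣ ≤ m)

  IsClique : Subset n → Set
  IsClique X = ∀ u v → u ∈ X → v ∈ X → u ≢ v → Adj u v

  CliqueNumberIs : ℕ → Set
  CliqueNumberIs m = (Σ (Subset n) λ X → IsClique X × ∣ X ∣ ≡ m)
                   × (∀ X → IsClique X → ∣ X ∣ ≤ m)

{-# OPTIONS --safe #-}
module Submission where

-- A clique is trivially k-ftmv, since it has no non-adjacent pairs. Conversely,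
-- the k+1 shortest paths joining two non-adjacent vertices of a k-ftmv set X
-- each have an internal vertex, these are pairwise distinct and lie outside X,
-- so |X| + k + 1 ≤ n. Hence a k-ftmv set of size at least n - ℓ ≥ n - k is a
-- clique, and on sets of size at least n - ℓ the two notions coincide, which
-- forces their maxima to equal n - ℓ simultaneously.

open import Defs
open import Data.Nat using (ℕ; zero; suc; _≤_; _<_; _+_)
import Data.Nat.Properties as ℕ
open import Data.Fin using (Fin; zero; suc; _≟_)
import Data.Fin.Properties as Fin
open import Data.Fin.Subset using (Subset; _∈_; _∉_; ∣_∣; _∪_; ⁅_⁆)
open import Data.Fin.Subset.Properties
  using (∣p∣≤n; p⊂q⇒∣p∣<∣q∣; p⊆p∪q; x∈⁅x⁆; x∈⁅y⁆⇒x≡y; x∈p∪q⁻; x∈p∪q⁺)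
open import Data.List using (List; []; _∷_)
import Data.List.Membership.Propositional as List
open import Data.List.Relation.Unary.Any using (here)
open import Data.Vec using (Vec; lookup)
open import Data.Product using (Σ; ∃; _×_; _,_; proj₁; proj₂)
open import Data.Sum using (inj₁; inj₂)
open import Data.Bool using (true; false)
open import Data.Empty using (⊥)
open import Function using (_∘_)
open import Function.Bundles using (_⇔_; mk⇔)
open import Function.Definitions using (Injective)
open import Relation.Nullary using (contradiction)
open import Relation.Nullary.Decidable using (decidable-stable)
open import Relation.Binary.PropositionalEquality
  using (_≡_; _≢_; refl; sym; trans; subst)

x∉p⇒∣p∣<∣p∪⁅x⁆∣ : ∀ {n} {x : Fin n} {p : Subset n} → x ∉ p → ∣ p ∣ < ∣ p ∪ ⁅ x ⁆ ∣
x∉p⇒∣p∣<∣p∪⁅x⁆∣ {x = x} x∉p =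
  p⊂q⇒∣p∣<∣q∣ (p⊆p∪q ⁅ x ⁆ , x , x∈p∪q⁺ (inj₂ (x∈⁅x⁆ x)) , x∉p)

injective-outside⇒∣p∣+m≤n : ∀ {m n} (p : Subset n) (f : Fin m → Fin n) →
  Injective _≡_ _≡_ f → (∀ i → f i ∉ p) → ∣ p ∣ + m ≤ n
injective-outside⇒∣p∣+m≤n {zero}  p f f-inj f∉p =
  subst (_≤ _) (sym (ℕ.+-identityʳ ∣ p ∣)) (∣p∣≤n p)
injective-outside⇒∣p∣+m≤n {suc m} {n} p f f-inj f∉p = begin
  ∣ p ∣ + suc m    ≡⟨ ℕ.+-suc ∣ p ∣ m ⟩
  suc ∣ p ∣ + m    ≤⟨ ℕ.+-monoˡ-≤ m (x∉p⇒∣p∣<∣p∪⁅x⁆∣ (f∉p zero)) ⟩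
  ∣ p′ ∣ + m       ≤⟨ injective-outside⇒∣p∣+m≤n p′ (f ∘ suc) (Fin.suc-injective ∘ f-inj) f∘suc∉p′ ⟩
  n                ∎
  where
  open ℕ.≤-Reasoning
  p′ : Subset n
  p′ = p ∪ ⁅ f zero ⁆
  f∘suc∉p′ : ∀ i → f (suc i) ∉ p′
  f∘suc∉p′ i fsi∈p′ with x∈p∪q⁻ p ⁅ f zero ⁆ fsi∈p′
  ... | inj₁ fsi∈p    = f∉p (suc i) fsi∈p
  ... | inj₂ fsi∈⁅f0⁆ = contradiction (f-inj (x∈⁅y⁆⇒x≡y (f zero) fsi∈⁅f0⁆)) λ ()

module _ {n : ℕ} (G : Graph n) where

  Chain-nonadjacent⇒internal : ∀ {u v} xs → Chain G u xs v → adj G u v ≡ false →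
    ∃ λ x → x List.∈ xs
  Chain-nonadjacent⇒internal []       u~v u≁v = contradiction (trans (sym u~v) u≁v) λ ()
  Chain-nonadjacent⇒internal (x ∷ xs) _   _   = x , here refl

  disjoint-chains-outside⇒∣X∣+m≤n : ∀ {m X u v} (Q : Vec (List (Fin n)) m) →
    adj G u v ≡ false → (∀ i → Chain G u (lookup Q i) v) →
    (∀ i j → i ≢ j → ∀ x → x List.∈ lookup Q i → x List.∈ lookup Q j → ⊥) →
    (∀ i x → x List.∈ lookup Q i → x ∉ X) → ∣ X ∣ + m ≤ n
  disjoint-chains-outside⇒∣X∣+m≤n {X = X} Q u≁v chain disjoint outside =
    injective-outside⇒∣p∣+m≤n X (proj₁ ∘ internal) internal-injective
      (λ i → outside i _ (proj₂ (internal i)))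
    where
    internal : ∀ i → ∃ λ x → x List.∈ lookup Q i
    internal i = Chain-nonadjacent⇒internal (lookup Q i) (chain i) u≁v
    internal-injective : Injective _≡_ _≡_ (proj₁ ∘ internal)
    internal-injective {i} {j} xᵢ≡xⱼ = decidable-stable (i ≟ j) λ i≢j →
      disjoint i j i≢j _ (proj₂ (internal i))
        (subst (List._∈ lookup Q j) (sym xᵢ≡xⱼ) (proj₂ (internal j)))

  ftmv-nonadjacent⇒∣X∣+1+k≤n : ∀ {k X u v} → IsKFTMV G k X →
    u ∈ X → v ∈ X → u ≢ v → adj G u v ≡ false → ∣ X ∣ + suc k ≤ n
  ftmv-nonadjacent⇒∣X∣+1+k≤n ftmv u∈X v∈X u≢v u≁v
    with Q , shortest , disjoint , outside ← ftmv _ _ u∈X v∈X u≢v u≁v =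
    disjoint-chains-outside⇒∣X∣+m≤n Q u≁v (proj₁ ∘ proj₁ ∘ shortest) disjoint outside

  large-ftmv⇒clique : ∀ {k X} → IsKFTMV G k X → n ≤ ∣ X ∣ + k → IsClique G X
  large-ftmv⇒clique {k} {X} ftmv n≤∣X∣+k u v u∈X v∈X u≢v with adj G u v in u≁v
  ... | true  = refl
  ... | false = contradiction
    (ℕ.+-cancelˡ-≤ ∣ X ∣ _ _ (ℕ.≤-trans (ftmv-nonadjacent⇒∣X∣+1+k≤n ftmv u∈X v∈X u≢v u≁v) n≤∣X∣+k))
    ℕ.1+n≰n

  clique⇒ftmv : ∀ {k X} → IsClique G X → IsKFTMV G k X
  clique⇒ftmv clique u v u∈X v∈X u≢v u≁v =
    contradiction (trans (sym (clique u v u∈X v∈X u≢v)) u≁v) λ ()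

module _ {A : Set} (size : A → ℕ) where

  MaxSizeIs : (A → Set) → ℕ → Set
  MaxSizeIs P m = (Σ A λ X → P X × size X ≡ m) × (∀ X → P X → size X ≤ m)

  MaxSizeIs-⇔ : ∀ {P Q : A → Set} {m} → (∀ X → P X → m ≤ size X → Q X) →
    (∀ X → Q X → P X) → MaxSizeIs P m ⇔ MaxSizeIs Q m
  MaxSizeIs-⇔ {P} {Q} {m} large-P⇒Q Q⇒P = mk⇔ to from
    where
    to : MaxSizeIs P m → MaxSizeIs Q m
    to ((X , PX , ∣X∣≡m) , P≤m) =
      (X , large-P⇒Q X PX (ℕ.≤-reflexive (sym ∣X∣≡m)) , ∣X∣≡m) , λ Y → P≤m Y ∘ Q⇒P Y
    from : MaxSizeIs Q m → MaxSizeIs P m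
    from ((X , QX , ∣X∣≡m) , Q≤m) = (X , Q⇒P X QX , ∣X∣≡m) , P≤m
      where
      P≤m : ∀ Y → P Y → size Y ≤ m
      P≤m Y PY with ℕ.≤-total (size Y) m
      ... | inj₁ ∣Y∣≤m = ∣Y∣≤m
      ... | inj₂ m≤∣Y∣ = Q≤m Y (large-P⇒Q Y PY m≤∣Y∣)

theorem5p1 : (n : ℕ) (G : Graph n) → Connected G →
    (k ℓ : ℕ) → ℓ ≤ k →
    (m : ℕ) → m + ℓ ≡ n →
    (FMuIs G k m ⇔ CliqueNumberIs G m)
theorem5p1 n G _ k ℓ ℓ≤k m m+ℓ≡n =
  MaxSizeIs-⇔ ∣_∣
    (λ X ftmv m≤∣X∣ → large-ftmv⇒clique G ftmv
      (subst (_≤ ∣ X ∣ + k) m+ℓ≡n (ℕ.+-mono-≤ m≤∣X∣ ℓ≤k)))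
    (λ X → clique⇒ftmv G)
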